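{- Let $T$ be a blossom tree with total charge $k\ge2$ and let $e$ be an edge of $T$. Let $c_\bullet$ and $c_\circ$ be the charges of $T_e^\bullet$ and $T_e^\circ$; then $c_\bullet+c_\circ=k$. (i) If the root of $T$ belongs to $T_e^\circ$, then $c_\bullet\le1$ and $c_\circ\ge k-1$; in particular both charge rules hold at $e$. (ii) If the root of $T$ belongs to $T_e^\bullet$, then $c_\circ\ge0$ and $c_\bullet\le k$.
   Context: All maps are planar, connected, considered up to orientation-preserving homeomorphism, and bipartite: vertices are black or white and each edge joins a black and a white vertex. Maps may carry half-edges attached to single vertices and lying in the infinite face. A half-edge at a white vertex is a leaf; one at a black vertex is a bud. A tree is such a map with a single face, rooted at one of its half-edges. Its charge is the number of leaves minus the number of buds, not counting the root half-edge; its total charge counts it. For an edge $e$ of a tree $T$, cutting $e$ into a leaf at its white end and a bud at its black end yields $T_e^\bullet$ (containing the black end) and $T_e^\circ$ (containing the white end), each rooted at its new half-edge. The black charge rule holds at $e$ if $T_e^\bullet$ has charge $\le1$. The white charge rule holds at $e$ if $T_e^\circ$ has charge $\ge0$. The lower subtree at $e$ is the one not containing the root of $T$. A blossom tree is a tree in which, at every edge, the lower subtree satisfies the charge rule of its colour. -}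

module Defs where

open import Data.List using (List; []; _∷_)
open import Data.Product using (Σ; _,_; proj₁; proj₂; _×_)
open import Data.Integer using (ℤ; +_; -_; _+_; _-_; _≤_; 1ℤ; 0ℤ)
open import Relation.Binary.PropositionalEquality using (_≡_)

data Colour : Set where
  black white : Colour

flip : Colour → Colour
flip black = white
flip white = black

-- Contribution of a half-edge at a vertex of the given colour:
-- a leaf (white vertex) counts +1, a bud (black vertex) counts -1.
sign : Colour → ℤ
sign white = + 1
sign black = - (+ 1)

-- A 'Node c' is a vertex of colour c seen from the edge/half-edge above it;
-- its children are listed in counterclockwise order starting after that
-- edge/half-edge.
-- Such ordered trees are exactly planar one-face maps up to
-- orientation-preserving homeomorphism, rooted at a half-edge.
mutual
  data Node : Colour → Set where
    node : ∀ {c} → List (Child c) → Node c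

  data Child : Colour → Set where
    half : ∀ {c} → Child c
    edge : ∀ {c} → Node (flip c) → Child c

-- A tree rooted at a half-edge: the colour of the vertex carrying the root
-- half-edge, and the node at that vertex (root half-edge above it).
Tree : Set
Tree = Σ Colour Node

mutual
  chargeN : ∀ {c} → Node c → ℤ
  chargeN (node cs) = chargeCs cs

  chargeCs : ∀ {c} → List (Child c) → ℤ
  chargeCs [] = 0ℤ
  chargeCs {c} (half ∷ cs) = sign c + chargeCs cs
  chargeCs (edge n ∷ cs) = chargeN n + chargeCs cs

-- Charge of a tree: leaves minus buds, not counting the root half-edge.
charge : Tree → ℤ
charge (c , n) = chargeN n

totalCharge : Tree → ℤ
totalCharge (c , n) = sign c + chargeN n

data EdgeL : {c : Colour} → List (Child c) → Set where
  here   : ∀ {c} {n : Node (flip c)} {cs : List (Child c)} → EdgeL (edge n ∷ cs)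
  inside : ∀ {c} {ds : List (Child (flip c))} {cs : List (Child c)} →
           EdgeL ds → EdgeL (edge (node ds) ∷ cs)
  there  : ∀ {c} {x : Child c} {cs : List (Child c)} → EdgeL cs → EdgeL (x ∷ cs)

Edge : Tree → Set
Edge (c , node cs) = EdgeL cs

-- The lower subtree at an edge (the side not containing the root of T),
-- rooted at the new half-edge created by cutting the edge; its colour is
-- the colour of the lower endpoint of the edge.
lowerL : ∀ {c} {cs : List (Child c)} → EdgeL cs → Tree
lowerL (here {c} {n}) = flip c , n
lowerL (inside e) = lowerL e
lowerL (there e) = lowerL e

upperColL : ∀ {c} {cs : List (Child c)} → EdgeL cs → Colour
upperColL (here {c}) = c
upperColL (inside e) = upperColL e
upperColL (there e) = upperColL e

upperCs : ∀ {c} {cs : List (Child c)} → EdgeL cs → List (Child c)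
upperCs (here {cs = cs}) = half ∷ cs
upperCs (inside {cs = cs} e) = edge (node (upperCs e)) ∷ cs
upperCs (there {x = x} e) = x ∷ upperCs e

lowerSub : (T : Tree) → Edge T → Tree
lowerSub (c , node cs) e = lowerL e

lowerCol : (T : Tree) → Edge T → Colour
lowerCol T e = proj₁ (lowerSub T e)

upperCol : (T : Tree) → Edge T → Colour
upperCol (c , node cs) e = upperColL e

-- The upper piece, still drawn with the root of T as its distinguished
-- half-edge; it contains the new half-edge at the upper endpoint.
upperPiece : (T : Tree) → Edge T → Tree
upperPiece (c , node cs) e = c , node (upperCs e)

lowerCharge : (T : Tree) → Edge T → ℤ
lowerCharge T e = charge (lowerSub T e)

-- Charge of the upper piece rooted at its new half-edge: all its
-- half-edges (including the old root of T) except the new one.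
upperCharge : (T : Tree) → Edge T → ℤ
upperCharge T e = totalCharge (upperPiece T e) - sign (upperCol T e)

-- c• = charge of T_e^• (piece containing the black endpoint),
-- c∘ = charge of T_e^∘ (piece containing the white endpoint).
cBlack : (T : Tree) → Edge T → ℤ
cBlack T e with lowerCol T e
... | black = lowerCharge T e
... | white = upperCharge T e

cWhite : (T : Tree) → Edge T → ℤ
cWhite T e with lowerCol T e
... | white = lowerCharge T e
... | black = upperCharge T e

BlackRule : (T : Tree) → Edge T → Set
BlackRule T e = cBlack T e ≤ 1ℤ

WhiteRule : (T : Tree) → Edge T → Set
WhiteRule T e = 0ℤ ≤ cWhite T e

-- The root of T lies in T_e^∘ iff the lower piece is T_e^•,
-- i.e. the lower endpoint of e is black.
RootInWhite : (T : Tree) → Edge T → Set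
RootInWhite T e = lowerCol T e ≡ black

RootInBlack : (T : Tree) → Edge T → Set
RootInBlack T e = lowerCol T e ≡ white

-- Charge rule of colour c for a tree (the charge of a tree rooted at a
-- half-edge whose end has colour c).
ChargeRule : Colour → ℤ → Set
ChargeRule black q = q ≤ 1ℤ
ChargeRule white q = 0ℤ ≤ q

IsBlossom : Tree → Set
IsBlossom T = (e : Edge T) → ChargeRule (lowerCol T e) (lowerCharge T e)

module Submission where

open import Defs
open import Data.Integer using (ℤ; +_; -_; _+_; _-_; _≤_; 0ℤ; 1ℤ; +≤+)
open import Data.Integer.Properties
  using (+-assoc; +-comm; +-identityʳ; +-commutativeSemigroup; +-monoʳ-≤; +-monoˡ-≤; neg-mono-≤; ≤-trans; ≤-reflexive)
open import Data.Integer.Tactic.RingSolver using (solve-∀)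
open import Algebra.Properties.CommutativeSemigroup +-commutativeSemigroup using (xy∙z≈xz∙y)
open import Data.List using (List; _∷_)
open import Data.Nat using (z≤n)
open import Data.Product using (_×_; _,_)
open import Relation.Binary.PropositionalEquality using (_≡_; refl; cong; sym; trans; module ≡-Reasoning)

childCharge : ∀ {c} → Child c → ℤ
childCharge {c} half = sign c
childCharge (edge n) = chargeN n

chargeCs-∷ : ∀ {c} (x : Child c) (cs : List (Child c)) →
  chargeCs (x ∷ cs) ≡ childCharge x + chargeCs cs
chargeCs-∷ half cs = refl
chargeCs-∷ (edge n) cs = refl

-- Cutting an edge trades the charge of the subtree below it for one new
-- half-edge at its upper endpoint.
chargeCs-upperCs : ∀ {c} {cs : List (Child c)} (e : EdgeL cs) →
  chargeCs (upperCs e) + charge (lowerL e) ≡ chargeCs cs + sign (upperColL e)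
chargeCs-upperCs (here {c} {n} {cs}) = rearrange (sign c) (chargeCs cs) (chargeN n)
  where
    rearrange : ∀ s r l → s + r + l ≡ l + r + s
    rearrange = solve-∀
chargeCs-upperCs (inside {ds = ds} {cs = cs} e) = begin
  chargeCs (upperCs e) + chargeCs cs + charge (lowerL e)
    ≡⟨ xy∙z≈xz∙y (chargeCs (upperCs e)) (chargeCs cs) (charge (lowerL e)) ⟩
  chargeCs (upperCs e) + charge (lowerL e) + chargeCs cs
    ≡⟨ cong (_+ chargeCs cs) (chargeCs-upperCs e) ⟩
  chargeCs ds + sign (upperColL e) + chargeCs cs
    ≡⟨ xy∙z≈xz∙y (chargeCs ds) (sign (upperColL e)) (chargeCs cs) ⟩
  chargeCs ds + chargeCs cs + sign (upperColL e) ∎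
  where open ≡-Reasoning
chargeCs-upperCs (there {x = x} {cs} e) = begin
  chargeCs (x ∷ upperCs e) + charge (lowerL e)
    ≡⟨ cong (_+ charge (lowerL e)) (chargeCs-∷ x (upperCs e)) ⟩
  childCharge x + chargeCs (upperCs e) + charge (lowerL e)
    ≡⟨ +-assoc (childCharge x) _ _ ⟩
  childCharge x + (chargeCs (upperCs e) + charge (lowerL e))
    ≡⟨ cong (λ z → childCharge x + z) (chargeCs-upperCs e) ⟩
  childCharge x + (chargeCs cs + sign (upperColL e))
    ≡⟨ sym (+-assoc (childCharge x) _ _) ⟩
  childCharge x + chargeCs cs + sign (upperColL e)
    ≡⟨ cong (_+ sign (upperColL e)) (sym (chargeCs-∷ x cs)) ⟩
  chargeCs (x ∷ cs) + sign (upperColL e) ∎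
  where open ≡-Reasoning

upperCharge+lowerCharge : (T : Tree) (e : Edge T) →
  upperCharge T e + lowerCharge T e ≡ totalCharge T
upperCharge+lowerCharge (c , node cs) e = begin
  sign c + chargeCs (upperCs e) - sign (upperColL e) + charge (lowerL e)
    ≡⟨ regroup (sign c) (chargeCs (upperCs e)) (sign (upperColL e)) (charge (lowerL e)) ⟩
  sign c + (chargeCs (upperCs e) + charge (lowerL e)) - sign (upperColL e)
    ≡⟨ cong (λ z → sign c + z - sign (upperColL e)) (chargeCs-upperCs e) ⟩
  sign c + (chargeCs cs + sign (upperColL e)) - sign (upperColL e)
    ≡⟨ cancel (sign c) (chargeCs cs) (sign (upperColL e)) ⟩
  sign c + chargeCs cs ∎
  where
    open ≡-Reasoning
    regroup : ∀ a u s l → a + u - s + l ≡ a + (u + l) - s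
    regroup = solve-∀
    cancel : ∀ a r s → a + (r + s) - s ≡ a + r
    cancel = solve-∀

cBlack+cWhite : (T : Tree) (e : Edge T) → cBlack T e + cWhite T e ≡ totalCharge T
cBlack+cWhite T e with lowerCol T e
... | black = trans (+-comm (lowerCharge T e) (upperCharge T e)) (upperCharge+lowerCharge T e)
... | white = upperCharge+lowerCharge T e

lowerChargeRule : (T : Tree) → IsBlossom T → (e : Edge T) → ∀ {c} → lowerCol T e ≡ c →
  ChargeRule c (lowerCharge T e)
lowerChargeRule T blossom e refl = blossom e

module Complement {u l k : ℤ} (u+l≡k : u + l ≡ k) where

  u≡k-l : u ≡ k - l
  u≡k-l = begin
    u         ≡⟨ cancel u l ⟩
    u + l - l ≡⟨ cong (_- l) u+l≡k ⟩
    k - l     ∎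
    where
      open ≡-Reasoning
      cancel : ∀ a b → a ≡ a + b - b
      cancel = solve-∀

  k-m≤u : ∀ {m} → l ≤ m → k - m ≤ u
  k-m≤u l≤m = ≤-trans (+-monoʳ-≤ k (neg-mono-≤ l≤m)) (≤-reflexive (sym u≡k-l))

  u≤k-m : ∀ {m} → m ≤ l → u ≤ k - m
  u≤k-m m≤l = ≤-trans (≤-reflexive u≡k-l) (+-monoʳ-≤ k (neg-mono-≤ m≤l))

lemma14 : (T : Tree) → IsBlossom T → (k : ℤ) → totalCharge T ≡ k → + 2 ≤ k →
    (e : Edge T) →
    (cBlack T e + cWhite T e ≡ k)
    × (RootInWhite T e → (cBlack T e ≤ 1ℤ) × (k - 1ℤ ≤ cWhite T e) × BlackRule T e × WhiteRule T e)
    × (RootInBlack T e → (0ℤ ≤ cWhite T e) × (cBlack T e ≤ k))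
lemma14 T blossom k refl 2≤k e with lowerCol T e in colour | cBlack+cWhite T e
... | black | sum =
  sum , (λ _ → lower≤1 , k-1≤upper , lower≤1 , 0≤upper) , λ ()
  where
    open Complement {upperCharge T e} {lowerCharge T e} (upperCharge+lowerCharge T e)
    lower≤1 : lowerCharge T e ≤ 1ℤ
    lower≤1 = lowerChargeRule T blossom e colour
    k-1≤upper : totalCharge T - 1ℤ ≤ upperCharge T e
    k-1≤upper = k-m≤u lower≤1
    0≤upper : 0ℤ ≤ upperCharge T e
    0≤upper = ≤-trans (≤-trans (+≤+ z≤n) (+-monoˡ-≤ (- 1ℤ) 2≤k)) k-1≤upper
... | white | sum =
  sum , (λ ()) , λ _ → 0≤lower , ≤-trans (u≤k-m 0≤lower) (≤-reflexive (+-identityʳ (totalCharge T)))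
  where
    open Complement {upperCharge T e} {lowerCharge T e} (upperCharge+lowerCharge T e)
    0≤lower : 0ℤ ≤ lowerCharge T e
    0≤lower = lowerChargeRule T blossom e colour
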